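{- Let $T$ be a lattice. Then: (a) $\mathcal{C}_L(T)$ is a lattice, and the map $\vartheta:\mathcal{C}_L(T)\to \mathcal{I}d(T)\times\mathcal{F}i(T)^*$ defined by $\vartheta(S):=(\downarrow S,\uparrow S)$ is a one-to-one lattice homomorphism whose image is $\mathcal{K}(T):=\{(I,F)\in \mathcal{I}d(T)\times \mathcal{F}i(T)^*: I\cap F\neq\emptyset\}$. (b) For $A,B\in\mathcal{C}_L(T)$: (i) $A\le B$ if and only if $a\vee b\in B$ and $a\wedge b\in A$ for every $a\in A$, $b\in B$; (ii) $A\vee B=\big(\downarrow\{a\vee b: a\in \downarrow A,\ b\in\downarrow B\}\big)\cap(\uparrow A)\cap(\uparrow B)$; (iii) $A\wedge B=(\downarrow A)\cap(\downarrow B)\cap\big(\uparrow\{a\wedge b: a\in\uparrow A,\ b\in\uparrow B\}\big)$.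
   Context: $\downarrow X$ and $\uparrow X$ denote the initial and final segments generated by $X$. $\mathcal{C}_L(T)$ is the set of nonempty convex sublattices of $T$ ordered by the bi-dominating order: $X\le Y$ iff every element of $X$ is below some element of $Y$ and every element of $Y$ is above some element of $X$. $\mathcal{I}d(T)$ is the lattice of ideals (nonempty initial segments closed under binary joins) of $T$ ordered by inclusion, with join $I\vee I'=\downarrow\{a\vee b: a\in I, b\in I'\}$ and meet $I\cap I'$; $\mathcal{F}i(T)$ is the lattice of filters (nonempty final segments closed under binary meets) ordered by inclusion, with join $\uparrow\{a\wedge b:a\in F,b\in F'\}$ and meet $F\cap F'$; $\mathcal{F}i(T)^*$ is its dual (reverse inclusion), and the product carries the componentwise order. In (ii) and (iii) the bracketed sets are the join in $\mathcal{I}d(T)$ of $\downarrow A,\downarrow B$ and the meet in $\mathcal{F}i(T)^*$ of $\uparrow A,\uparrow B$ respectively. -}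

module Defs where

open import Level using (Level; _⊔_; suc)
open import Data.Product using (Σ; ∃; ∃₂; _×_; _,_)
open import Relation.Unary using (Pred; _∩_; _⊆_; _≐_; Satisfiable)
open import Relation.Binary.Lattice.Bundles using (Lattice)

module LatticeDefs {c ℓ₁ ℓ₂ : Level} (T : Lattice c ℓ₁ ℓ₂) where
  open Lattice T

  Lv : Level
  Lv = c ⊔ ℓ₁ ⊔ ℓ₂

  Subset : Set (suc Lv)
  Subset = Pred Carrier Lv

  ↓ : Subset → Subset
  ↓ X = λ y → ∃ λ x → X x × y ≤ x

  ↑ : Subset → Subset
  ↑ X = λ y → ∃ λ x → X x × x ≤ y

  Convex : Subset → Set Lv
  Convex S = ∀ {x y z} → S x → S z → x ≤ y → y ≤ z → S y

  IsSublattice : Subset → Set Lv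
  IsSublattice S = ∀ {x y} → S x → S y → S (x ∨ y) × S (x ∧ y)

  record CL : Set (suc Lv) where
    field
      set        : Subset
      nonempty   : Satisfiable set
      convex     : Convex set
      sublattice : IsSublattice set
  open CL public

  _≐ᶜ_ : CL → CL → Set Lv
  A ≐ᶜ B = set A ≐ set B

  _⊑_ : Subset → Subset → Set Lv
  X ⊑ Y = (∀ {x} → X x → ∃ λ y → Y y × x ≤ y)
        × (∀ {y} → Y y → ∃ λ x → X x × x ≤ y)

  _≤ᵇ_ : CL → CL → Set Lv
  A ≤ᵇ B = set A ⊑ set B

  IsIdeal : Subset → Set Lv
  IsIdeal I = Satisfiable I
            × (∀ {x y} → y ≤ x → I x → I y)
            × (∀ {x y} → I x → I y → I (x ∨ y))

  IsFilter : Subset → Set Lv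
  IsFilter F = Satisfiable F
             × (∀ {x y} → x ≤ y → F x → F y)
             × (∀ {x y} → F x → F y → F (x ∧ y))

  joins : Subset → Subset → Subset
  joins X Y = λ z → ∃₂ λ a b → X a × Y b × z ≈ (a ∨ b)

  meets : Subset → Subset → Subset
  meets X Y = λ z → ∃₂ λ a b → X a × Y b × z ≈ (a ∧ b)

  IdJoin : Subset → Subset → Subset
  IdJoin I I' = ↓ (joins I I')

  IdMeet : Subset → Subset → Subset
  IdMeet I I' = I ∩ I'

  -- join in Fi(T): ↑{a ∧ b}; meet is ∩.  In the dual Fi(T)^* these swap:
  FiStarJoin : Subset → Subset → Subset
  FiStarJoin F F' = F ∩ F'

  FiStarMeet : Subset → Subset → Subset
  FiStarMeet F F' = ↑ (meets F F')

  ϑ₁ : CL → Subset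
  ϑ₁ S = ↓ (set S)

  ϑ₂ : CL → Subset
  ϑ₂ S = ↑ (set S)

  InK : Subset → Subset → Set Lv
  InK I F = IsIdeal I × IsFilter F × Satisfiable (I ∩ F)

-- By convexity a convex sublattice S is ↓S ∩ ↑S, and A ≤ B in the bi-dominating
-- order says exactly ↓A ⊆ ↓B and ↑B ⊆ ↑A.  So ϑ is an order embedding into
-- Id(T) × Fi(T)^*, and every pair (I, F) with I ∩ F ≠ ∅ is ϑ(I ∩ F).  The image K(T)
-- is closed under the componentwise operations (for a ∈ A, b ∈ B, the element a ∨ b,
-- resp. a ∧ b, lies in both components), so A ∨ B and A ∧ B are the sets I ∩ F of the
-- componentwise join and meet.  For (b)(i): if a ≤ b' ∈ B then b ≤ a ∨ b ≤ b' ∨ b ∈ B,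
-- and convexity puts a ∨ b into B.
module Submission where

open import Defs
open import Level using (Level)
open import Data.Product using (Σ; ∃; _×_; _,_; proj₁; proj₂)
open import Relation.Unary using (Pred; _∩_; _≐_; _⊆_; Satisfiable)
open import Relation.Unary.Properties using (≐-refl; ≐-sym; ≐-trans)
open import Relation.Binary.Core using (_⇒_)
open import Relation.Binary.Definitions using (Transitive; Antisymmetric)
open import Relation.Binary.Structures using (IsEquivalence; IsPartialOrder)
open import Relation.Binary.Lattice.Bundles using (Lattice)
open import Relation.Binary.Lattice.Structures using (IsLattice)
open import Relation.Binary.Lattice.Definitions using (Supremum; Infimum)
open import Relation.Binary.Lattice.Properties.Lattice using (∧-∨-lattice)
import Relation.Binary.Lattice.Properties.JoinSemilattice as JoinSemilatticeProperties
import Relation.Binary.Lattice.Properties.MeetSemilattice as MeetSemilatticeProperties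

∩-assoc : ∀ {a ℓ₁ ℓ₂ ℓ₃} {A : Set a} {P : Pred A ℓ₁} {Q : Pred A ℓ₂} {R : Pred A ℓ₃} →
          (P ∩ Q) ∩ R ≐ P ∩ (Q ∩ R)
∩-assoc = (λ ((p , q) , r) → p , q , r) , (λ (p , q , r) → (p , q) , r)

module IdealTheory {c ℓ₁ ℓ₂ : Level} (T : Lattice c ℓ₁ ℓ₂) where
  open Lattice T
  open LatticeDefs T
  open JoinSemilatticeProperties joinSemilattice using (∨-monotonic)

  private variable
    x y : Carrier
    X I I' J : Subset

  ⊆↓ : X ⊆ ↓ X
  ⊆↓ x∈X = _ , x∈X , refl

  ↓-lower : y ≤ x → ↓ X x → ↓ X y
  ↓-lower y≤x (z , z∈X , x≤z) = z , z∈X , trans y≤x x≤z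

  ↓-least : IsIdeal I → X ⊆ I → ↓ X ⊆ I
  ↓-least (_ , lower , _) X⊆I (x , x∈X , y≤x) = lower y≤x (X⊆I x∈X)

  ↓-isIdeal : Satisfiable X → (∀ {x y} → X x → X y → X (x ∨ y)) → IsIdeal (↓ X)
  ↓-isIdeal (x , x∈X) ∨-closed = (x , ⊆↓ x∈X) , ↓-lower , λ (u , u∈X , x≤u) (v , v∈X , y≤v) →
    u ∨ v , ∨-closed u∈X v∈X , ∨-monotonic x≤u y≤v

  ∩-isIdeal : IsIdeal I → IsIdeal I' → IsIdeal (I ∩ I')
  ∩-isIdeal ((a , a∈I) , lower , ∨-closed) ((b , b∈I') , lower' , ∨-closed') =
      (a ∧ b , lower (x∧y≤x a b) a∈I , lower' (x∧y≤y a b) b∈I')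
    , (λ y≤x (x∈I , x∈I') → lower y≤x x∈I , lower' y≤x x∈I')
    , λ (x∈I , x∈I') (y∈I , y∈I') → ∨-closed x∈I y∈I , ∨-closed' x∈I' y∈I'

  ∨∈IdJoin : I x → I' y → IdJoin I I' (x ∨ y)
  ∨∈IdJoin x∈I y∈I' = _ , (_ , _ , x∈I , y∈I' , Eq.refl) , refl

  IdJoin-upperˡ : Satisfiable I' → I ⊆ IdJoin I I'
  IdJoin-upperˡ (y , y∈I') {x} x∈I = ↓-lower (x≤x∨y x y) (∨∈IdJoin x∈I y∈I')

  IdJoin-upperʳ : Satisfiable I → I' ⊆ IdJoin I I'
  IdJoin-upperʳ (x , x∈I) {y} y∈I' = ↓-lower (y≤x∨y x y) (∨∈IdJoin x∈I y∈I')

  IdJoin-least : IsIdeal J → I ⊆ J → I' ⊆ J → IdJoin I I' ⊆ J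
  IdJoin-least (_ , lower , ∨-closed) I⊆J I'⊆J (_ , (_ , _ , a∈I , b∈I' , z≈a∨b) , x≤z) =
    lower (trans x≤z (reflexive z≈a∨b)) (∨-closed (I⊆J a∈I) (I'⊆J b∈I'))

  IdJoin-isIdeal : IsIdeal I → IsIdeal I' → IsIdeal (IdJoin I I')
  IdJoin-isIdeal {I} {I'} ((a , a∈I) , _ , ∨-closed) ((b , b∈I') , _ , ∨-closed') =
    (a ∨ b , ∨∈IdJoin a∈I b∈I') , ↓-lower , ∨-closedᴶ
    where
    ∨-closedᴶ : IdJoin I I' x → IdJoin I I' y → IdJoin I I' (x ∨ y)
    ∨-closedᴶ (_ , (a₁ , b₁ , a₁∈I , b₁∈I' , z₁≈) , x≤z₁)
              (_ , (a₂ , b₂ , a₂∈I , b₂∈I' , z₂≈) , y≤z₂) =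
      ↓-lower (∨-least (trans x≤z₁ (trans (reflexive z₁≈) (∨-monotonic (x≤x∨y a₁ a₂) (x≤x∨y b₁ b₂))))
                       (trans y≤z₂ (trans (reflexive z₂≈) (∨-monotonic (y≤x∨y a₁ a₂) (y≤x∨y b₁ b₂)))))
              (∨∈IdJoin (∨-closed a₁∈I a₂∈I) (∨-closed' b₁∈I' b₂∈I'))

module ConvexSublattices {c ℓ₁ ℓ₂ : Level} (T : Lattice c ℓ₁ ℓ₂) where
  open Lattice T
  open LatticeDefs T
  open JoinSemilatticeProperties joinSemilattice using (∨-monotonic)
  open MeetSemilatticeProperties meetSemilattice using (∧-monotonic)
  open IdealTheory T
  -- Filters of T are the ideals of the dual lattice; there ↓ is ↑ and IdJoin is FiStarMeet.
  open IdealTheory (∧-∨-lattice T) using () renaming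
    ( ⊆↓ to ⊆↑; ↓-lower to ↑-upper; ↓-least to ↑-least; ↓-isIdeal to ↑-isFilter
    ; ∩-isIdeal to ∩-isFilter; ∨∈IdJoin to ∧∈FiStarMeet
    ; IdJoin-upperˡ to FiStarMeet-lowerˡ; IdJoin-upperʳ to FiStarMeet-lowerʳ
    ; IdJoin-least to FiStarMeet-greatest; IdJoin-isIdeal to FiStarMeet-isFilter )

  private variable
    a b : Carrier

  ϑ₁-isIdeal : ∀ S → IsIdeal (ϑ₁ S)
  ϑ₁-isIdeal S = ↓-isIdeal (nonempty S) (λ x∈S y∈S → proj₁ (sublattice S x∈S y∈S))

  ϑ₂-isFilter : ∀ S → IsFilter (ϑ₂ S)
  ϑ₂-isFilter S = ↑-isFilter (nonempty S) (λ x∈S y∈S → proj₂ (sublattice S x∈S y∈S))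

  ϑ-inK : ∀ S → InK (ϑ₁ S) (ϑ₂ S)
  ϑ-inK S = let (s , s∈S) = nonempty S in ϑ₁-isIdeal S , ϑ₂-isFilter S , s , ⊆↓ s∈S , ⊆↑ s∈S

  ϑ₁∩ϑ₂⊆set : ∀ S → ϑ₁ S ∩ ϑ₂ S ⊆ set S
  ϑ₁∩ϑ₂⊆set S ((u , u∈S , x≤u) , (l , l∈S , l≤x)) = convex S l∈S u∈S l≤x x≤u

  ϑ-injective : ∀ A B → ϑ₁ A ≐ ϑ₁ B → ϑ₂ A ≐ ϑ₂ B → A ≐ᶜ B
  ϑ-injective A B (↓A⊆↓B , ↓B⊆↓A) (↑A⊆↑B , ↑B⊆↑A) =
      (λ a∈A → ϑ₁∩ϑ₂⊆set B (↓A⊆↓B (⊆↓ a∈A) , ↑A⊆↑B (⊆↑ a∈A)))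
    , (λ b∈B → ϑ₁∩ϑ₂⊆set A (↓B⊆↓A (⊆↓ b∈B) , ↑B⊆↑A (⊆↑ b∈B)))

  ideal∩filter : ∀ I F → InK I F → CL
  set (ideal∩filter I F _) = I ∩ F
  nonempty (ideal∩filter I F (_ , _ , w∈I∩F)) = w∈I∩F
  convex (ideal∩filter I F ((_ , lower , _) , (_ , upper , _) , _)) (_ , x∈F) (z∈I , _) x≤y y≤z =
    lower y≤z z∈I , upper x≤y x∈F
  sublattice (ideal∩filter I F ((_ , lower , ∨-closed) , (_ , upper , ∧-closed) , _))
             {x} {y} (x∈I , x∈F) (y∈I , y∈F) =
    (∨-closed x∈I y∈I , upper (x≤x∨y x y) x∈F) , (lower (x∧y≤x x y) x∈I , ∧-closed x∈F y∈F)

  -- For x ∈ I, the witness w ∈ I ∩ F gives x ≤ x ∨ w ∈ I ∩ F.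
  ϑ-ideal∩filter : ∀ I F (k : InK I F) → (ϑ₁ (ideal∩filter I F k) ≐ I) × (ϑ₂ (ideal∩filter I F k) ≐ F)
  ϑ-ideal∩filter I F (I-ideal@(_ , lower , ∨-closed) , F-filter@(_ , upper , ∧-closed) , w , w∈I , w∈F) =
      ( ↓-least I-ideal proj₁
      , λ {x} x∈I → x ∨ w , (∨-closed x∈I w∈I , upper (y≤x∨y x w) w∈F) , x≤x∨y x w )
    , ( ↑-least F-filter proj₂
      , λ {x} x∈F → x ∧ w , (lower (x∧y≤y x w) w∈I , ∧-closed x∈F w∈F) , x∧y≤x x w )

  ≤ᵇ⇒ϑ-⊆ : ∀ A B → A ≤ᵇ B → ϑ₁ A ⊆ ϑ₁ B × ϑ₂ B ⊆ ϑ₂ A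
  ≤ᵇ⇒ϑ-⊆ A B (A⊆↓B , B⊆↑A) = ↓-least (ϑ₁-isIdeal B) A⊆↓B , ↑-least (ϑ₂-isFilter A) B⊆↑A

  ϑ-⊆⇒≤ᵇ : ∀ A B → ϑ₁ A ⊆ ϑ₁ B → ϑ₂ B ⊆ ϑ₂ A → A ≤ᵇ B
  ϑ-⊆⇒≤ᵇ A B ↓A⊆↓B ↑B⊆↑A = (λ a∈A → ↓A⊆↓B (⊆↓ a∈A)) , (λ b∈B → ↑B⊆↑A (⊆↑ b∈B))

  ≐ᶜ-isEquivalence : IsEquivalence _≐ᶜ_
  ≐ᶜ-isEquivalence = record { refl = ≐-refl ; sym = ≐-sym ; trans = ≐-trans }

  ≐ᶜ⇒≤ᵇ : _≐ᶜ_ ⇒ _≤ᵇ_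
  ≐ᶜ⇒≤ᵇ (A⊆B , B⊆A) = (λ a∈A → ⊆↓ (A⊆B a∈A)) , (λ b∈B → ⊆↑ (B⊆A b∈B))

  ≤ᵇ-trans : Transitive _≤ᵇ_
  ≤ᵇ-trans {A} {B} {C} A≤B B≤C =
    let (↓A⊆↓B , ↑B⊆↑A) = ≤ᵇ⇒ϑ-⊆ A B A≤B
        (↓B⊆↓C , ↑C⊆↑B) = ≤ᵇ⇒ϑ-⊆ B C B≤C
    in ϑ-⊆⇒≤ᵇ A C (λ x∈↓A → ↓B⊆↓C (↓A⊆↓B x∈↓A)) (λ x∈↑C → ↑B⊆↑A (↑C⊆↑B x∈↑C))

  ≤ᵇ-antisym : Antisymmetric _≐ᶜ_ _≤ᵇ_
  ≤ᵇ-antisym {A} {B} A≤B B≤A =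
    let (↓A⊆↓B , ↑B⊆↑A) = ≤ᵇ⇒ϑ-⊆ A B A≤B
        (↓B⊆↓A , ↑A⊆↑B) = ≤ᵇ⇒ϑ-⊆ B A B≤A
    in ϑ-injective A B (↓A⊆↓B , ↓B⊆↓A) (↑A⊆↑B , ↑B⊆↑A)

  ≤ᵇ-isPartialOrder : IsPartialOrder _≐ᶜ_ _≤ᵇ_
  ≤ᵇ-isPartialOrder = record
    { isPreorder = record
      { isEquivalence = ≐ᶜ-isEquivalence
      ; reflexive = λ {A} {B} → ≐ᶜ⇒≤ᵇ {A} {B}
      ; trans = λ {A} {B} {C} → ≤ᵇ-trans {A} {B} {C}
      }
    ; antisym = λ {A} {B} → ≤ᵇ-antisym {A} {B}
    }

  ⊔ᶜ-inK : ∀ A B → InK (IdJoin (ϑ₁ A) (ϑ₁ B)) (FiStarJoin (ϑ₂ A) (ϑ₂ B))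
  ⊔ᶜ-inK A B =
    let (a , a∈A) = nonempty A ; (b , b∈B) = nonempty B in
      IdJoin-isIdeal (ϑ₁-isIdeal A) (ϑ₁-isIdeal B) , ∩-isFilter (ϑ₂-isFilter A) (ϑ₂-isFilter B)
    , a ∨ b , ∨∈IdJoin (⊆↓ a∈A) (⊆↓ b∈B) , ↑-upper (x≤x∨y a b) (⊆↑ a∈A) , ↑-upper (y≤x∨y a b) (⊆↑ b∈B)

  ⊓ᶜ-inK : ∀ A B → InK (IdMeet (ϑ₁ A) (ϑ₁ B)) (FiStarMeet (ϑ₂ A) (ϑ₂ B))
  ⊓ᶜ-inK A B =
    let (a , a∈A) = nonempty A ; (b , b∈B) = nonempty B in
      ∩-isIdeal (ϑ₁-isIdeal A) (ϑ₁-isIdeal B) , FiStarMeet-isFilter (ϑ₂-isFilter A) (ϑ₂-isFilter B)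
    , a ∧ b , (↓-lower (x∧y≤x a b) (⊆↓ a∈A) , ↓-lower (x∧y≤y a b) (⊆↓ b∈B)) , ∧∈FiStarMeet (⊆↑ a∈A) (⊆↑ b∈B)

  _⊔ᶜ_ : CL → CL → CL
  A ⊔ᶜ B = ideal∩filter _ _ (⊔ᶜ-inK A B)

  _⊓ᶜ_ : CL → CL → CL
  A ⊓ᶜ B = ideal∩filter _ _ (⊓ᶜ-inK A B)

  ϑ-⊔ᶜ : ∀ A B → (ϑ₁ (A ⊔ᶜ B) ≐ IdJoin (ϑ₁ A) (ϑ₁ B)) × (ϑ₂ (A ⊔ᶜ B) ≐ FiStarJoin (ϑ₂ A) (ϑ₂ B))
  ϑ-⊔ᶜ A B = ϑ-ideal∩filter _ _ (⊔ᶜ-inK A B)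

  ϑ-⊓ᶜ : ∀ A B → (ϑ₁ (A ⊓ᶜ B) ≐ IdMeet (ϑ₁ A) (ϑ₁ B)) × (ϑ₂ (A ⊓ᶜ B) ≐ FiStarMeet (ϑ₂ A) (ϑ₂ B))
  ϑ-⊓ᶜ A B = ϑ-ideal∩filter _ _ (⊓ᶜ-inK A B)

  ⊔ᶜ-supremum : Supremum _≤ᵇ_ _⊔ᶜ_
  ⊔ᶜ-supremum A B =
    let ((↓A⊔B⊆↓J , ↓J⊆↓A⊔B) , (↑A⊔B⊆↑∩ , ↑∩⊆↑A⊔B)) = ϑ-⊔ᶜ A B in
      ϑ-⊆⇒≤ᵇ A (A ⊔ᶜ B) (λ x∈↓A → ↓J⊆↓A⊔B (IdJoin-upperˡ (proj₁ (ϑ₁-isIdeal B)) x∈↓A))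
                        (λ x∈↑A⊔B → proj₁ (↑A⊔B⊆↑∩ x∈↑A⊔B))
    , ϑ-⊆⇒≤ᵇ B (A ⊔ᶜ B) (λ x∈↓B → ↓J⊆↓A⊔B (IdJoin-upperʳ (proj₁ (ϑ₁-isIdeal A)) x∈↓B))
                        (λ x∈↑A⊔B → proj₂ (↑A⊔B⊆↑∩ x∈↑A⊔B))
    , λ C A≤C B≤C →
        let (↓A⊆↓C , ↑C⊆↑A) = ≤ᵇ⇒ϑ-⊆ A C A≤C
            (↓B⊆↓C , ↑C⊆↑B) = ≤ᵇ⇒ϑ-⊆ B C B≤C
        in ϑ-⊆⇒≤ᵇ (A ⊔ᶜ B) C (λ x∈↓A⊔B → IdJoin-least (ϑ₁-isIdeal C) ↓A⊆↓C ↓B⊆↓C (↓A⊔B⊆↓J x∈↓A⊔B))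
                             (λ x∈↑C → ↑∩⊆↑A⊔B (↑C⊆↑A x∈↑C , ↑C⊆↑B x∈↑C))

  ⊓ᶜ-infimum : Infimum _≤ᵇ_ _⊓ᶜ_
  ⊓ᶜ-infimum A B =
    let ((↓A⊓B⊆↓∩ , ↓∩⊆↓A⊓B) , (↑A⊓B⊆↑M , ↑M⊆↑A⊓B)) = ϑ-⊓ᶜ A B in
      ϑ-⊆⇒≤ᵇ (A ⊓ᶜ B) A (λ x∈↓A⊓B → proj₁ (↓A⊓B⊆↓∩ x∈↓A⊓B))
                        (λ x∈↑A → ↑M⊆↑A⊓B (FiStarMeet-lowerˡ (proj₁ (ϑ₂-isFilter B)) x∈↑A))
    , ϑ-⊆⇒≤ᵇ (A ⊓ᶜ B) B (λ x∈↓A⊓B → proj₂ (↓A⊓B⊆↓∩ x∈↓A⊓B))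
                        (λ x∈↑B → ↑M⊆↑A⊓B (FiStarMeet-lowerʳ (proj₁ (ϑ₂-isFilter A)) x∈↑B))
    , λ C C≤A C≤B →
        let (↓C⊆↓A , ↑A⊆↑C) = ≤ᵇ⇒ϑ-⊆ C A C≤A
            (↓C⊆↓B , ↑B⊆↑C) = ≤ᵇ⇒ϑ-⊆ C B C≤B
        in ϑ-⊆⇒≤ᵇ C (A ⊓ᶜ B) (λ x∈↓C → ↓∩⊆↓A⊓B (↓C⊆↓A x∈↓C , ↓C⊆↓B x∈↓C))
                             (λ x∈↑A⊓B → FiStarMeet-greatest (ϑ₂-isFilter C) ↑A⊆↑C ↑B⊆↑C (↑A⊓B⊆↑M x∈↑A⊓B))

  ≤ᵇ-isLattice : IsLattice _≐ᶜ_ _≤ᵇ_ _⊔ᶜ_ _⊓ᶜ_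
  ≤ᵇ-isLattice = record
    { isPartialOrder = ≤ᵇ-isPartialOrder ; supremum = ⊔ᶜ-supremum ; infimum = ⊓ᶜ-infimum }

  ≤ᵇ⇒∨∈ : ∀ A B → A ≤ᵇ B → set A a → set B b → set B (a ∨ b)
  ≤ᵇ⇒∨∈ {a} {b} A B (A⊆↓B , _) a∈A b∈B =
    let (b' , b'∈B , a≤b') = A⊆↓B a∈A in
    convex B b∈B (proj₁ (sublattice B b'∈B b∈B)) (y≤x∨y a b) (∨-monotonic a≤b' refl)

  ≤ᵇ⇒∧∈ : ∀ A B → A ≤ᵇ B → set A a → set B b → set A (a ∧ b)
  ≤ᵇ⇒∧∈ {a} {b} A B (_ , B⊆↑A) a∈A b∈B =
    let (a' , a'∈A , a'≤b) = B⊆↑A b∈B in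
    convex A (proj₂ (sublattice A a∈A a'∈A)) a∈A (∧-monotonic refl a'≤b) (x∧y≤x a b)

  ∨∧-closed⇒≤ᵇ : ∀ A B → (∀ {a b} → set A a → set B b → set B (a ∨ b) × set A (a ∧ b)) → A ≤ᵇ B
  ∨∧-closed⇒≤ᵇ A B closed =
      (λ {a} a∈A → let (b , b∈B) = nonempty B in a ∨ b , proj₁ (closed a∈A b∈B) , x≤x∨y a b)
    , (λ {b} b∈B → let (a , a∈A) = nonempty A in a ∧ b , proj₂ (closed a∈A b∈B) , x∧y≤y a b)

mainTheorem8 : ∀ {c ℓ₁ ℓ₂ : Level} (T : Lattice c ℓ₁ ℓ₂) →
  let open Lattice T
      open LatticeDefs T
  in
  Σ (CL → CL → CL) (λ _⊔_ → Σ (CL → CL → CL) (λ _⊓_ →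
    IsLattice _≐ᶜ_ _≤ᵇ_ _⊔_ _⊓_
    × (∀ S → InK (ϑ₁ S) (ϑ₂ S))
    × (∀ I F → InK I F → ∃ λ S → (ϑ₁ S ≐ I) × (ϑ₂ S ≐ F))
    × (∀ A B → ϑ₁ A ≐ ϑ₁ B → ϑ₂ A ≐ ϑ₂ B → A ≐ᶜ B)
    × (∀ A B → (ϑ₁ (A ⊔ B) ≐ IdJoin (ϑ₁ A) (ϑ₁ B))
              × (ϑ₂ (A ⊔ B) ≐ FiStarJoin (ϑ₂ A) (ϑ₂ B)))
    × (∀ A B → (ϑ₁ (A ⊓ B) ≐ IdMeet (ϑ₁ A) (ϑ₁ B))
              × (ϑ₂ (A ⊓ B) ≐ FiStarMeet (ϑ₂ A) (ϑ₂ B)))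
    × (∀ A B → (A ≤ᵇ B → ∀ {a b} → set A a → set B b
                                   → set B (a ∨ b) × set A (a ∧ b))
              × ((∀ {a b} → set A a → set B b
                            → set B (a ∨ b) × set A (a ∧ b)) → A ≤ᵇ B))
    × (∀ A B → set (A ⊔ B) ≐ (↓ (joins (↓ (set A)) (↓ (set B))) ∩ ↑ (set A) ∩ ↑ (set B)))
    × (∀ A B → set (A ⊓ B) ≐ (↓ (set A) ∩ ↓ (set B) ∩ ↑ (meets (↑ (set A)) (↑ (set B)))))))
mainTheorem8 T = let open ConvexSublattices T in
    _⊔ᶜ_ , _⊓ᶜ_ , ≤ᵇ-isLattice
  , ϑ-inK
  , (λ I F k → ideal∩filter I F k , ϑ-ideal∩filter I F k)
  , ϑ-injective
  , ϑ-⊔ᶜ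
  , ϑ-⊓ᶜ
  , (λ A B → (λ A≤B a∈A b∈B → ≤ᵇ⇒∨∈ A B A≤B a∈A b∈B , ≤ᵇ⇒∧∈ A B A≤B a∈A b∈B) , ∨∧-closed⇒≤ᵇ A B)
  , (λ A B → ≐-refl)
  , (λ A B → ∩-assoc)
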